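{- Let $\mathcal{X}$ be an $n$-premaniplex, $(\mathcal{Y}_1,\eta_1)$ an $(n,m)$-voltage operator and $(\mathcal{Y}_2,\eta_2)$ an $(m,\ell)$-voltage operator. Define $\theta:\Pi(\mathcal{Y}_1\rtimes_{\eta_2}\mathcal{Y}_2)\to\mathrm{Mon}(\mathcal{U}^n)$ by \[\theta\big({}^{\omega}(y_1,y_2)\big):=\eta_1\big({}^{\eta_2({}^{\omega}y_2)}y_1\big)\] for all vertices $(y_1,y_2)$ and all $\omega\in\mathrm{Mon}(\mathcal{U}^\ell)$. Then \[(\mathcal{X}\rtimes_{\eta_1}\mathcal{Y}_1)\rtimes_{\eta_2}\mathcal{Y}_2\cong\mathcal{X}\rtimes_{\theta}(\mathcal{Y}_1\rtimes_{\eta_2}\mathcal{Y}_2).\]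
   Context: Graphs may have semiedges and parallel edges. A $k$-premaniplex is a graph whose darts are colored by $\{0,\dots,k-1\}$ (a dart and its inverse have the same color) such that every vertex is the starting point of exactly one dart of each color, and for $|i-j|\ge 2$ every path of length 4 alternating colors $i,j$ is closed. For a vertex $x$, ${}^i x$ denotes the dart of color $i$ starting at $x$, and $x^i$ its endpoint. For each $k$, $\mathrm{Mon}(\mathcal U^k)=\langle r_0,\dots,r_{k-1}\mid r_i^2=1,\ (r_ir_j)^2=1 \text{ for } |i-j|\ge2\rangle$ acts on the left on the vertex set of every $k$-premaniplex by $r_i x=x^i$. Paths are considered up to maniplex homotopy (inserting/deleting two consecutive darts of the same color, or swapping two consecutive colors $i,j$ with $|i-j|\ge2$); $\Pi(\mathcal Z)$ is the set of homotopy classes of paths. For $\omega=r_{i_k}\cdots r_{i_1}$, ${}^{\omega}z$ denotes the class of the path starting at $z$ following colors $i_1,\dots,i_k$ in that order. A voltage assignment $\eta$ with group $G$ assigns $\eta(d)\in G$ to each dart $d$ with $\eta(d^{ -1})=\eta(d)^{ -1}$; the voltage of a path $d_1\cdots d_k$ is $\eta(d_k)\cdots\eta(d_1)$. An $(n,m)$-voltage operator is a pair $(\mathcal Y,\eta)$ with $\mathcal Y$ an $m$-premaniplex and $\eta$ a voltage assignment with group $\mathrm{Mon}(\mathcal U^n)$ such that every length-4 path alternating between colors $i,j$ with $|i-j|\ge2$ has trivial voltage. For an $n$-premaniplex $\mathcal X$, $\mathcal X\rtimes_\eta\mathcal Y$ is the $m$-premaniplex on $V(\mathcal X)\times V(\mathcal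 Y)$ where for each color $i$ there is an edge of color $i$ joining $(x,y)$ and $(\eta({}^i y)x,\ y^i)$. -}

module Defs where

open import Data.Nat using (ℕ; _+_; _≤_)
open import Data.Fin using (Fin; toℕ)
open import Data.List using (List; []; _∷_; _++_; reverse)
open import Data.Product using (Σ; _×_; _,_; proj₁; proj₂)
open import Data.Sum using (_⊎_)
open import Function.Bundles using (_↔_; Inverse)
open import Relation.Binary.PropositionalEquality using (_≡_)

Far : ∀ {k} → Fin k → Fin k → Set
Far i j = (toℕ i + 2 ≤ toℕ j) ⊎ (toℕ j + 2 ≤ toℕ i)

-- Elements of Mon(U^k) are represented by words in the generators r_i.
-- The list  i_k ∷ ... ∷ i_1 ∷ []  represents  r_{i_k} ⋯ r_{i_1}
-- (head = leftmost factor); group product = _++_, r_i⁻¹ = r_i.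
Word : ℕ → Set
Word k = List (Fin k)

-- Equality in Mon(U^k): the congruence generated by the defining
-- relations r_i² = 1 and (r_i r_j)² = 1 (|i-j| ≥ 2), i.e. the equivalence
-- closure of deleting "i i" and swapping "i j" with |i-j| ≥ 2 inside a word.
infix 4 _≈w_
data _≈w_ {k : ℕ} : Word k → Word k → Set where
  w-refl   : ∀ {u} → u ≈w u
  w-sym    : ∀ {u v} → u ≈w v → v ≈w u
  w-trans  : ∀ {u v w} → u ≈w v → v ≈w w → u ≈w w
  w-cancel : ∀ u i v → (u ++ i ∷ i ∷ v) ≈w (u ++ v)
  w-swap   : ∀ u i j v → Far i j → (u ++ i ∷ j ∷ v) ≈w (u ++ j ∷ i ∷ v)

-- A k-colored graph in which every vertex starts exactly one dart of each
-- colour: the dart ^i x is determined by (x , i), and  step i x = x^i.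
-- (A semiedge of colour i at x is a fixed point of step i.)
record ColGraph (k : ℕ) : Set₁ where
  field
    V    : Set
    step : Fin k → V → V
open ColGraph public

IsPremaniplex : ∀ {k} → ColGraph k → Set
IsPremaniplex {k} X =
  (∀ (i : Fin k) x → step X i (step X i x) ≡ x)
  × (∀ (i j : Fin k) → Far i j → ∀ x →
       step X j (step X i (step X j (step X i x))) ≡ x)

act : ∀ {k} (X : ColGraph k) → Word k → V X → V X
act X []      x = x
act X (i ∷ w) x = step X i (act X w x)

Voltage : ∀ {k} → ColGraph k → ℕ → Set
Voltage {k} Y n = V Y → Fin k → Word n

-- voltage of the path starting at y following (the colours of) ω:
-- for ω = r_{i_k}⋯r_{i_1} the path has colours i_1,…,i_k and voltage
-- η(d_k)⋯η(d_1)
pathVoltage : ∀ {k n} (Y : ColGraph k) → Voltage Y n → V Y → Word k → Word n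
pathVoltage Y η y []      = []
pathVoltage Y η y (i ∷ w) = η (act Y w y) i ++ pathVoltage Y η y w

IsVoltageAssignment : ∀ {k n} (Y : ColGraph k) → Voltage Y n → Set
IsVoltageAssignment {k} Y η = ∀ y (i : Fin k) → η (step Y i y) i ≈w reverse (η y i)

IsVoltageOperator : ∀ {m n} (Y : ColGraph m) → Voltage Y n → Set
IsVoltageOperator {m} Y η =
  IsPremaniplex Y × IsVoltageAssignment Y η
  × (∀ (i j : Fin m) → Far i j → ∀ y →
       pathVoltage Y η y (j ∷ i ∷ j ∷ i ∷ []) ≈w [])

⋊ : ∀ {n m} (X : ColGraph n) (Y : ColGraph m) → Voltage Y n → ColGraph m
⋊ X Y η = record
  { V = V X × V Y ; step = λ i p → act X (η (proj₂ p) i) (proj₁ p) , step Y i (proj₂ p) }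

θPath : ∀ {n m l} (Y₁ : ColGraph m) (η₁ : Voltage Y₁ n)
        (Y₂ : ColGraph l) (η₂ : Voltage Y₂ m) → V Y₁ × V Y₂ → Word l → Word n
θPath Y₁ η₁ Y₂ η₂ p ω = pathVoltage Y₁ η₁ (proj₁ p) (pathVoltage Y₂ η₂ (proj₂ p) ω)

θ : ∀ {n m l} (Y₁ : ColGraph m) (η₁ : Voltage Y₁ n)
    (Y₂ : ColGraph l) (η₂ : Voltage Y₂ m) → Voltage (⋊ Y₁ Y₂ η₂) n
θ Y₁ η₁ Y₂ η₂ p i = θPath Y₁ η₁ Y₂ η₂ p (i ∷ [])

_≅_ : ∀ {k} → ColGraph k → ColGraph k → Set
_≅_ {k} A B = Σ (V A ↔ V B) λ e →
  ∀ (i : Fin k) v → Inverse.to e (step A i v) ≡ step B i (Inverse.to e v)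

-- The isomorphism is the reassociation ((x , y₁) , y₂) ↦ (x , (y₁ , y₂)).
-- A word w acts on X ⋊_η Y by acting with w on the Y-coordinate and with the
-- voltage of the path of colours w on the X-coordinate.  Hence a colour-i step
-- in (X ⋊_{η₁} Y₁) ⋊_{η₂} Y₂ moves x by η₁ applied along the path η₂(^i y₂)
-- from y₁, which is exactly θ(^i (y₁ , y₂)).
module Submission where

open import Defs
open import Data.List using ([]; _∷_; _++_)
open import Data.List.Properties using (++-identityʳ)
open import Data.Product using (_×_; _,_)
open import Function.Bundles using (_↔_; Inverse; mk↔ₛ′)
open import Relation.Binary.PropositionalEquality

act-++ : ∀ {k} (X : ColGraph k) a b x → act X (a ++ b) x ≡ act X a (act X b x)
act-++ X []      b x = refl
act-++ X (i ∷ a) b x = cong (step X i) (act-++ X a b x)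

act-⋊ : ∀ {n m} (X : ColGraph n) (Y : ColGraph m) (η : Voltage Y n) w x y →
        act (⋊ X Y η) w (x , y) ≡ (act X (pathVoltage Y η y w) x , act Y w y)
act-⋊ X Y η []      x y = refl
act-⋊ X Y η (i ∷ w) x y = begin
  step (⋊ X Y η) i (act (⋊ X Y η) w (x , y))
    ≡⟨ cong (step (⋊ X Y η) i) (act-⋊ X Y η w x y) ⟩
  (act X (η (act Y w y) i) (act X (pathVoltage Y η y w) x) , step Y i (act Y w y))
    ≡⟨ cong (_, step Y i (act Y w y))
            (sym (act-++ X (η (act Y w y) i) (pathVoltage Y η y w) x)) ⟩
  (act X (pathVoltage Y η y (i ∷ w)) x , act Y (i ∷ w) y)
    ∎
  where open ≡-Reasoning

θ-dart : ∀ {n m l} (Y₁ : ColGraph m) (η₁ : Voltage Y₁ n) (Y₂ : ColGraph l)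
         (η₂ : Voltage Y₂ m) y₁ y₂ i →
         θ Y₁ η₁ Y₂ η₂ (y₁ , y₂) i ≡ pathVoltage Y₁ η₁ y₁ (η₂ y₂ i)
θ-dart Y₁ η₁ Y₂ η₂ y₁ y₂ i = cong (pathVoltage Y₁ η₁ y₁) (++-identityʳ (η₂ y₂ i))

⋊-assoc : ∀ {n m l} (X : ColGraph n) (Y₁ : ColGraph m) (η₁ : Voltage Y₁ n)
          (Y₂ : ColGraph l) (η₂ : Voltage Y₂ m) →
          ⋊ (⋊ X Y₁ η₁) Y₂ η₂ ≅ ⋊ X (⋊ Y₁ Y₂ η₂) (θ Y₁ η₁ Y₂ η₂)
⋊-assoc X Y₁ η₁ Y₂ η₂ = reassoc , reassoc-step
  where
  reassoc : ((V X × V Y₁) × V Y₂) ↔ (V X × (V Y₁ × V Y₂))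
  reassoc = mk↔ₛ′ (λ { ((x , y₁) , y₂) → x , (y₁ , y₂) })
                  (λ { (x , (y₁ , y₂)) → (x , y₁) , y₂ })
                  (λ _ → refl) (λ _ → refl)

  reassoc-step : ∀ i p → Inverse.to reassoc (step (⋊ (⋊ X Y₁ η₁) Y₂ η₂) i p)
                       ≡ step (⋊ X (⋊ Y₁ Y₂ η₂) (θ Y₁ η₁ Y₂ η₂)) i (Inverse.to reassoc p)
  reassoc-step i ((x , y₁) , y₂)
    rewrite act-⋊ X Y₁ η₁ (η₂ y₂ i) x y₁ | θ-dart Y₁ η₁ Y₂ η₂ y₁ y₂ i = refl

theorem6p1 : ∀ {n m l} (X : ColGraph n) (Y₁ : ColGraph m) (η₁ : Voltage Y₁ n)
               (Y₂ : ColGraph l) (η₂ : Voltage Y₂ m) →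
               IsPremaniplex X → IsVoltageOperator Y₁ η₁ → IsVoltageOperator Y₂ η₂ →
               ⋊ (⋊ X Y₁ η₁) Y₂ η₂ ≅ ⋊ X (⋊ Y₁ Y₂ η₂) (θ Y₁ η₁ Y₂ η₂)
theorem6p1 X Y₁ η₁ Y₂ η₂ _ _ _ = ⋊-assoc X Y₁ η₁ Y₂ η₂
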